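{- Let $\mathcal{A}=(V,V_0,V_1,E)$ be an arena, $\mathrm{Cst}$ a cost function and $\Omega$ a coloring, and assume that no vertex has both an incoming increment-edge and an incoming $\epsilon$-edge; let $I$ be the set of vertices with an incoming increment-edge. Let $O$ be the set of odd colors in $\Omega(V)$ and define the memory structure $\mathcal{M}=(M,\mathrm{Init},\mathrm{Upd})$ with $M=O\cup\{\bot\}$, $\mathrm{Init}(v)=\Omega(v)$ if $\Omega(v)$ is odd and $\mathrm{Init}(v)=\bot$ otherwise, $\mathrm{Upd}(\bot,v)=\mathrm{Init}(v)$, and for $c\in O$: $\mathrm{Upd}(c,v)=\max(\Omega(v),c)$ if $\Omega(v)$ is odd, $\mathrm{Upd}(c,v)=\bot$ if $\Omega(v)\in\mathrm{Ans}(c)$, and $\mathrm{Upd}(c,v)=c$ otherwise. Let $\ell$ be an odd number larger than every color in $\Omega(V)$ and define $\Omega_{\mathcal{M}}:V\times M\to\mathbb{N}$ by $\Omega_{\mathcal{M}}(v,m)=\ell+1$ if $m=\bot$, $\Omega_{\mathcal{M}}(v,m)=\ell$ if $m\ne\bot$ and $v\in I$, and $\Omega_{\mathcal{M}}(v,m)=\Omega(v)$ otherwise. Then $(\mathcal{A},\mathrm{PCRR}(\Omega,I))\le_{\mathcal{M}}(\mathcal{A}\times\mathcal{M},\mathrm{Parity}(\Omega_{\mathcal{M}}))$; that is, for every play $\rho=\rho_0\rho_1\cdots$ in $\mathcal{A}$ with extended play $\rho'=(\rho_0,m_0)(\rho_1,m_1)\cdots$ (where $m_0=\mathrm{Init}(\rho_0)$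 and $m_{n+1}=\mathrm{Upd}(m_n,\rho_{n+1})$), we have $\rho\in\mathrm{PCRR}(\Omega,I)$ if and only if $\rho'\in\mathrm{Parity}(\Omega_{\mathcal{M}})$.
   Context: An arena is a tuple $\mathcal{A}=(V,V_0,V_1,E)$ where $(V,E)$ is a finite directed graph in which every vertex has at least one outgoing edge, and $\{V_0,V_1\}$ is a partition of $V$. A play is an infinite path in $(V,E)$. For a memory structure $\mathcal{M}=(M,\mathrm{Init},\mathrm{Upd})$ ($M$ finite, $\mathrm{Init}:V\to M$, $\mathrm{Upd}:M\times V\to M$), the expanded arena $\mathcal{A}\times\mathcal{M}$ has vertices $V\times M$, Player $0$ vertices $V_0\times M$, Player $1$ vertices $V_1\times M$, and an edge from $(v,m)$ to $(v',m')$ iff $(v,v')\in E$ and $\mathrm{Upd}(m,v')=m'$. A game $(\mathcal{A},\mathrm{Win})$ is reducible to $(\mathcal{A}\times\mathcal{M},\mathrm{Win}')$ via $\mathcal{M}$, written $\le_{\mathcal{M}}$, if every play $\rho$ of $\mathcal{A}$ satisfies $\rho\in\mathrm{Win}$ iff its extended play is in $\mathrm{Win}'$. A cost function is $\mathrm{Cst}:E\to\{\epsilon,i\}$; edges labelled $i$ are increment-edges and those labelled $\epsilon$ are $\epsilon$-edges. A coloring is $\Omega:V\to\mathbb{N}$; $\mathrm{Ans}(c)=\{c'\in\mathbb{N}:c'\ge c,\ c'\text{ even}\}$. In a play $\rho$, the request at position $k$ is answered if there is $k'\ge k$ with $\Omega(\rho_{k'})\in\mathrm{Ans}(\Omega(\rho_k))$.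 For a coloring $\Omega'$ of some vertex set, $\mathrm{Parity}(\Omega')$ is the set of plays whose maximal color seen infinitely often is even. $\mathrm{coB\ddot{u}chi}(I)$ is the set of plays visiting $I$ only finitely often; $\mathrm{RR}(\Omega)$ is the set of plays in which every request is answered; $\mathrm{PCRR}(\Omega,I)=(\mathrm{Parity}(\Omega)\cap\mathrm{coB\ddot{u}chi}(I))\cup\mathrm{RR}(\Omega)$. -}

module Defs where

open import Data.Nat using (ℕ; zero; suc; _≤_; _<_; _≥_; _⊔_)
open import Data.Nat.Properties using (_≟_; _≤?_)
open import Data.Nat.DivMod using (_%_)
open import Data.Fin using (Fin)
open import Data.Fin.Properties using (any?)
open import Data.Bool using (Bool; true; false; if_then_else_)
open import Data.Maybe using (Maybe; just; nothing)
open import Data.Product using (Σ; ∃; _×_; _,_)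
open import Data.Sum using (_⊎_)
open import Data.Empty using (⊥)
open import Relation.Nullary using (¬_; Dec; yes; no; does)
open import Relation.Nullary.Decidable using (_×-dec_)
open import Relation.Binary.PropositionalEquality using (_≡_)

record Arena (n : ℕ) : Set where
  field
    owner    : Fin n → Bool          -- true = Player 0 vertex (V₀), false = V₁
    E        : Fin n → Fin n → Bool
    outgoing : ∀ v → Σ (Fin n) λ v' → E v v' ≡ true

open Arena public

record Play {n : ℕ} (A : Arena n) : Set where
  field
    ρ    : ℕ → Fin n
    path : ∀ k → E A (ρ k) (ρ (suc k)) ≡ true

open Play public

data Cost : Set where
  ε inc : Cost

-- A cost function; only its values on edges of the arena are meaningful.
CostFun : ℕ → Set
CostFun n = Fin n → Fin n → Cost

NoMixedIncoming : ∀ {n} → Arena n → CostFun n → Set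
NoMixedIncoming {n} A Cst =
  ∀ (u u' v : Fin n) → E A u v ≡ true → E A u' v ≡ true →
    Cst u v ≡ inc → Cst u' v ≡ ε → ⊥

InI : ∀ {n} → Arena n → CostFun n → Fin n → Set
InI {n} A Cst v = ∃ λ (u : Fin n) → (E A u v ≡ true × Cst u v ≡ inc)

InI? : ∀ {n} (A : Arena n) (Cst : CostFun n) (v : Fin n) → Dec (InI A Cst v)
InI? A Cst v = any? (λ u → (Data.Bool._≟_ (E A u v) true) ×-dec (cost≟ (Cst u v) inc))
  where
  import Data.Bool
  cost≟ : (a b : Cost) → Dec (a ≡ b)
  cost≟ ε ε = yes _≡_.refl
  cost≟ ε inc = no λ ()
  cost≟ inc ε = no λ ()
  cost≟ inc inc = yes _≡_.refl

Even Odd : ℕ → Set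
Even c = c % 2 ≡ 0
Odd  c = c % 2 ≡ 1

isOdd : ℕ → Bool
isOdd c = does (c % 2 ≟ 1)

Ans : ℕ → ℕ → Set
Ans c c' = c ≤ c' × Even c'

Ans? : ∀ c c' → Dec (Ans c c')
Ans? c c' = (c ≤? c') ×-dec (c' % 2 ≟ 0)

MaxInf : (ℕ → ℕ) → ℕ → Set
MaxInf col c = (∀ k → ∃ λ k' → k' ≥ k × col k' ≡ c)
             × (∃ λ k₀ → ∀ k → k ≥ k₀ → col k ≤ c)

ParitySeq : (ℕ → ℕ) → Set
ParitySeq col = ∃ λ c → MaxInf col c × Even c

Parity : ∀ {n} {A : Arena n} → (Fin n → ℕ) → Play A → Set
Parity Ω p = ParitySeq (λ k → Ω (ρ p k))

coBuchi : ∀ {n} {A : Arena n} → (Fin n → Set) → Play A → Set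
coBuchi I p = ∃ λ k₀ → ∀ k → k ≥ k₀ → ¬ I (ρ p k)

RR : ∀ {n} {A : Arena n} → (Fin n → ℕ) → Play A → Set
RR Ω p = ∀ k → ∃ λ k' → k' ≥ k × Ans (Ω (ρ p k)) (Ω (ρ p k'))

PCRR : ∀ {n} {A : Arena n} → (Fin n → ℕ) → (Fin n → Set) → Play A → Set
PCRR Ω I p = (Parity Ω p × coBuchi I p) ⊎ RR Ω p

-- the memory structure  M = O ∪ {⊥}, with ⊥ = nothing and c ∈ O as just c

record MemoryStructure (n : ℕ) (Mem : Set) : Set where
  field
    Init : Fin n → Mem
    Upd  : Mem → Fin n → Mem

open MemoryStructure public

Mem : Set
Mem = Maybe ℕ

InitΩ : ∀ {n} → (Fin n → ℕ) → Fin n → Mem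
InitΩ Ω v = if isOdd (Ω v) then just (Ω v) else nothing

UpdΩ : ∀ {n} → (Fin n → ℕ) → Mem → Fin n → Mem
UpdΩ Ω nothing  v = InitΩ Ω v
UpdΩ Ω (just c) v with isOdd (Ω v) | does (Ans? c (Ω v))
... | true  | _     = just (Ω v ⊔ c)
... | false | true  = nothing
... | false | false = just c

𝓜 : ∀ {n} → (Fin n → ℕ) → MemoryStructure n Mem
𝓜 Ω = record { Init = InitΩ Ω ; Upd = UpdΩ Ω }

memSeq : ∀ {n} {M : Set} → MemoryStructure n M → (ℕ → Fin n) → ℕ → M
memSeq 𝓜' ρ' zero    = Init 𝓜' (ρ' zero)
memSeq 𝓜' ρ' (suc k) = Upd 𝓜' (memSeq 𝓜' ρ' k) (ρ' (suc k))

Ω𝓜 : ∀ {n} (A : Arena n) (Cst : CostFun n) (Ω : Fin n → ℕ) (ℓ : ℕ) →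
     Fin n → Mem → ℕ
Ω𝓜 A Cst Ω ℓ v nothing  = suc ℓ
Ω𝓜 A Cst Ω ℓ v (just _) = if does (InI? A Cst v) then ℓ else Ω v

ParityExtended : ∀ {n} {A : Arena n} → (Fin n → Mem → ℕ) → MemoryStructure n Mem →
                 Play A → Set
ParityExtended Ω' 𝓜' p =
  ParitySeq (λ k → Ω' (ρ p k) (memSeq 𝓜' (ρ p) k))

-- The memory holds the largest odd colour requested since its last reset, and it is reset
-- (to nothing, of top colour ℓ + 1) exactly when that request is answered. If every request is
-- answered, the memory can be raised only finitely often between resets, since its values are
-- colours below ℓ, so resets recur and the play is won; conversely recurring resets answer
-- every request. If resets stop, Ω𝓜 eventually equals Ω outside I and the odd colour ℓ above
-- all of Ω on I, so parity of Ω𝓜 is then parity of Ω together with coBüchi(I). Conversely, under parity and coBüchi with maximal recurring colour c, either the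
-- memory eventually exceeds c, never resets again and Ω𝓜 eventually equals Ω, or it stays at
-- most c and is reset at every later visit of the even colour c.
module Submission where

open import Defs
open import Data.Nat using (ℕ; zero; suc; _+_; _∸_; _⊔_; _≤_; _<_; _≥_; _≤′_; ≤′-refl; ≤′-step; _≤?_; s≤s)
open import Data.Nat.Properties
open import Data.Nat.DivMod using (_%_; m%n<n; %-distribˡ-+)
open import Data.Fin using (Fin)
open import Data.Bool using (true; false; if_then_else_)
open import Data.Maybe using (just; nothing)
open import Data.Product using (∃; _×_; _,_; proj₂; uncurry)
open import Data.Sum using (_⊎_; inj₁; inj₂; [_,_])
open import Function.Bundles using (_⇔_; mk⇔)
open import Relation.Nullary using (¬_; yes; no; does; contradiction)
open import Relation.Nullary.Decidable using (dec-true; dec-false)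
open import Relation.Binary.PropositionalEquality using (_≡_; refl; sym; trans; cong; subst)

even⊎odd : ∀ c → Even c ⊎ Odd c
even⊎odd c with c % 2 | m%n<n c 2
... | 0           | _                = inj₁ refl
... | 1           | _                = inj₂ refl
... | suc (suc _) | s≤s (s≤s ())

even⇒¬odd : ∀ c → Even c → ¬ Odd c
even⇒¬odd _ e o with () ← trans (sym e) o

odd⇒isOdd : ∀ c → Odd c → isOdd c ≡ true
odd⇒isOdd c = dec-true (c % 2 ≟ 1)

even⇒¬isOdd : ∀ c → Even c → isOdd c ≡ false
even⇒¬isOdd c e = dec-false (c % 2 ≟ 1) (even⇒¬odd c e)

odd⇒even-suc : ∀ c → Odd c → Even (suc c)
odd⇒even-suc c o = trans (%-distribˡ-+ 1 c 2) (cong (λ r → (1 + r) % 2) o)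

odd⇒¬Ans : ∀ {c} d → Odd d → ¬ Ans c d
odd⇒¬Ans d o (_ , e) = even⇒¬odd d e o

InfinitelyOften : (ℕ → Set) → Set
InfinitelyOften P = ∀ k → ∃ λ k′ → k′ ≥ k × P k′

parity-top : ∀ (f : ℕ → ℕ) {b} → Even b → (∀ k → f k ≤ b) → InfinitelyOften (λ k → f k ≡ b) →
             ParitySeq f
parity-top f e f≤b occ = _ , (occ , 0 , λ k _ → f≤b k) , e

parity-eventually-equal : ∀ {f g : ℕ → ℕ} K → (∀ k → k ≥ K → f k ≡ g k) → ParitySeq f → ParitySeq g
parity-eventually-equal {f} {g} K f≡g (c , (occ , k₀ , f≤c) , e) = c , (occ′ , k₀ ⊔ K , g≤c) , e
  where
  occ′ : InfinitelyOften (λ k → g k ≡ c)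
  occ′ k with k′ , k⊔K≤k′ , fk′≡c ← occ (k ⊔ K) =
    k′ , ≤-trans (m≤m⊔n k K) k⊔K≤k′ , trans (sym (f≡g k′ (≤-trans (m≤n⊔m k K) k⊔K≤k′))) fk′≡c
  g≤c : ∀ k → k ≥ k₀ ⊔ K → g k ≤ c
  g≤c k k₀⊔K≤k = subst (_≤ c) (f≡g k (≤-trans (m≤n⊔m k₀ K) k₀⊔K≤k)) (f≤c k (≤-trans (m≤m⊔n k₀ K) k₀⊔K≤k))

Below : ℕ → Mem → Set
Below c x = x ≡ nothing ⊎ ∃ λ d → x ≡ just d × d ≤ c

Above : ℕ → Mem → Set
Above c x = ∃ λ d → x ≡ just d × c < d

below⊎above : ∀ c x → Below c x ⊎ Above c x
below⊎above c nothing  = inj₁ (inj₁ refl)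
below⊎above c (just d) with d ≤? c
... | yes d≤c = inj₁ (inj₂ (d , refl , d≤c))
... | no d≰c  = inj₂ (d , refl , ≰⇒> d≰c)

module Update {n} (Ω : Fin n → ℕ) where

  init-even : ∀ {v} → Even (Ω v) → InitΩ Ω v ≡ nothing
  init-even {v} e = cong (λ b → if b then just (Ω v) else nothing) (even⇒¬isOdd (Ω v) e)

  init-odd : ∀ {v} → Odd (Ω v) → InitΩ Ω v ≡ just (Ω v)
  init-odd {v} o = cong (λ b → if b then just (Ω v) else nothing) (odd⇒isOdd (Ω v) o)

  -- UpdΩ is defined by `with`, so `rewrite` cannot reach its scrutinees; they are abstracted explicitly.
  upd-odd : ∀ {c v} → Odd (Ω v) → UpdΩ Ω (just c) v ≡ just (Ω v ⊔ c)
  upd-odd {c} {v} o with isOdd (Ω v) | odd⇒isOdd (Ω v) o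
  ... | .true | refl = refl

  upd-answered : ∀ {c v} → Ans c (Ω v) → UpdΩ Ω (just c) v ≡ nothing
  upd-answered {c} {v} a
    with isOdd (Ω v) | even⇒¬isOdd (Ω v) (proj₂ a) | does (Ans? c (Ω v)) | dec-true (Ans? c (Ω v)) a
  ... | .false | refl | .true | refl = refl

  upd-unanswered : ∀ {c v} → Even (Ω v) → ¬ Ans c (Ω v) → UpdΩ Ω (just c) v ≡ just c
  upd-unanswered {c} {v} e na
    with isOdd (Ω v) | even⇒¬isOdd (Ω v) e | does (Ans? c (Ω v)) | dec-false (Ans? c (Ω v)) na
  ... | .false | refl | .false | refl = refl

  data UpdateOf (c : ℕ) (v : Fin n) : Set where
    reset : Ans c (Ω v) → UpdΩ Ω (just c) v ≡ nothing → UpdateOf c v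
    keep  : ¬ Ans c (Ω v) → UpdΩ Ω (just c) v ≡ just c → UpdateOf c v
    raise : Odd (Ω v) → c < Ω v → UpdΩ Ω (just c) v ≡ just (Ω v) → UpdateOf c v

  updateOf : ∀ c v → UpdateOf c v
  updateOf c v with even⊎odd (Ω v)
  ... | inj₁ e with Ans? c (Ω v)
  ...   | yes a = reset a (upd-answered a)
  ...   | no na = keep na (upd-unanswered e na)
  updateOf c v | inj₂ o with Ω v ≤? c
  ...   | yes Ωv≤c = keep (odd⇒¬Ans (Ω v) o) (trans (upd-odd o) (cong just (m≤n⇒m⊔n≡n Ωv≤c)))
  ...   | no Ωv≰c = raise o (≰⇒> Ωv≰c) (trans (upd-odd o) (cong just (m≥n⇒m⊔n≡m (<⇒≤ (≰⇒> Ωv≰c)))))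

  init-just : ∀ {v d} → InitΩ Ω v ≡ just d → Odd (Ω v) × Ω v ≡ d
  init-just {v} eq with even⊎odd (Ω v)
  ... | inj₁ e with () ← trans (sym (init-even e)) eq
  ... | inj₂ o with refl ← trans (sym (init-odd o)) eq = o , refl

  odd-recorded : ∀ x {v} → Odd (Ω v) → ∃ λ e → UpdΩ Ω x v ≡ just e × Ω v ≤ e
  odd-recorded nothing  o = _ , init-odd o , ≤-refl
  odd-recorded (just c) o = _ , upd-odd o , m≤m⊔n _ c

  below-step : ∀ {c} x {v} → Below c x → Ω v ≤ c → Below c (UpdΩ Ω x v)
  below-step nothing {v} _ Ωv≤c with even⊎odd (Ω v)
  ... | inj₁ e = inj₁ (init-even e)
  ... | inj₂ o = inj₂ (_ , init-odd o , Ωv≤c)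
  below-step (just d) (inj₂ (d , refl , d≤c)) Ωv≤c with updateOf d _
  ... | reset _ eq     = inj₁ eq
  ... | keep _ eq      = inj₂ (d , eq , d≤c)
  ... | raise _ _ eq   = inj₂ (_ , eq , Ωv≤c)

  below-reset : ∀ {c} x {v} → Even c → Below c x → Ω v ≡ c → UpdΩ Ω x v ≡ nothing
  below-reset nothing e _ refl = init-even e
  below-reset (just d) e (inj₂ (d , refl , d≤c)) refl = upd-answered (d≤c , e)

  above-step : ∀ {c} x {v} → Above c x → Ω v ≤ c → Above c (UpdΩ Ω x v)
  above-step (just d) (d , refl , c<d) Ωv≤c with updateOf d _
  ... | reset (d≤Ωv , _) _ = contradiction (≤-trans d≤Ωv Ωv≤c) (<⇒≱ c<d)
  ... | keep _ eq          = d , eq , c<d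
  ... | raise _ d<Ωv _     = contradiction (<-trans c<d d<Ωv) (≤⇒≯ Ωv≤c)

module Memory {n} (Ω : Fin n → ℕ) (ρ : ℕ → Fin n) where
  open Update Ω

  col : ℕ → ℕ
  col k = Ω (ρ k)

  mem : ℕ → Mem
  mem = memSeq (𝓜 Ω) ρ

  mem-suc : ∀ {k x} → mem k ≡ x → mem (suc k) ≡ UpdΩ Ω x (ρ (suc k))
  mem-suc {k} = cong (λ x → UpdΩ Ω x (ρ (suc k)))

  mem-odd : ∀ k → Odd (col k) → ∃ λ e → mem k ≡ just e × col k ≤ e
  mem-odd zero    = odd-recorded nothing
  mem-odd (suc k) = odd-recorded (mem k)

  invariant : ∀ (P : Mem → Set) {K} → (∀ i → K ≤ i → P (mem i) → P (mem (suc i))) →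
              P (mem K) → ∀ {k} → K ≤′ k → P (mem k)
  invariant P step base ≤′-refl     = base
  invariant P step base (≤′-step p) = step _ (≤′⇒≤ p) (invariant P step base p)

  answered-or-pending : ∀ {k k′} → k ≤′ k′ →
    (∃ λ i → i ≥ k × Ans (col k) (col i)) ⊎ (∃ λ d → mem k′ ≡ just d × col k ≤ d)
  answered-or-pending {k} ≤′-refl with even⊎odd (col k)
  ... | inj₁ e = inj₁ (k , ≤-refl , ≤-refl , e)
  ... | inj₂ o = inj₂ (mem-odd k o)
  answered-or-pending {k} (≤′-step {k′} p) with answered-or-pending p
  ... | inj₁ a = inj₁ a
  ... | inj₂ (d , eq , ck≤d) with updateOf d (ρ (suc k′))
  ...   | reset (d≤ , e) _  = inj₁ (suc k′ , ≤′⇒≤ (≤′-step p) , ≤-trans ck≤d d≤ , e)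
  ...   | keep _ eq′        = inj₂ (d , trans (mem-suc eq) eq′ , ck≤d)
  ...   | raise _ d< eq′    = inj₂ (_ , trans (mem-suc eq) eq′ , ≤-trans ck≤d (<⇒≤ d<))

  reset⇒answered : ∀ {k k′} → k ≤ k′ → mem k′ ≡ nothing → ∃ λ i → i ≥ k × Ans (col k) (col i)
  reset⇒answered k≤k′ r with answered-or-pending (≤⇒≤′ k≤k′)
  ... | inj₁ a = a
  ... | inj₂ (_ , eq , _) with () ← trans (sym r) eq

  Pending : ℕ → ℕ → ℕ → Set
  Pending d j k = col j ≡ d × (∀ i → i ≥ j → i ≤ k → ¬ Ans d (col i))

  pending-fresh : ∀ {k} → Odd (col k) → Pending (col k) k k
  pending-fresh {k} o = refl , λ i k≤i i≤k →
    subst (λ i → ¬ Ans (col k) (col i)) (≤-antisym k≤i i≤k) (odd⇒¬Ans (col k) o)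

  pending-extend : ∀ {d j k} → Pending d j k → ¬ Ans d (col (suc k)) → Pending d j (suc k)
  pending-extend {d} {j} {k} (cj , quiet) na = cj , quiet′
    where
    quiet′ : ∀ i → i ≥ j → i ≤ suc k → ¬ Ans d (col i)
    quiet′ i j≤i i≤1+k with m≤n⇒m<n∨m≡n i≤1+k
    ... | inj₁ i<1+k = quiet i j≤i (m<1+n⇒m≤n i<1+k)
    ... | inj₂ refl  = na

  memory-pending : ∀ k {d} → mem k ≡ just d → ∃ λ j → j ≤ k × Pending d j k
  memory-pending zero h with o , refl ← init-just h = 0 , ≤-refl , pending-fresh o
  memory-pending (suc k) h with mem k in eq
  ... | nothing with o , refl ← init-just h = suc k , ≤-refl , pending-fresh o
  ... | just c with updateOf c (ρ (suc k))
  ...   | reset _ eq′ with () ← trans (sym eq′) h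
  ...   | raise o _ eq′ with refl ← trans (sym eq′) h = suc k , ≤-refl , pending-fresh o
  ...   | keep na eq′ with refl ← trans (sym eq′) h with memory-pending k eq
  ...     | j , j≤k , p = j , m≤n⇒m≤1+n j≤k , pending-extend p na

  Escapes : ℕ → ℕ → Set
  Escapes k d = ∃ λ i → i ≥ k × (mem i ≡ nothing ⊎ Above d (mem i))

  escapes-later : ∀ {k d} → Escapes (suc k) d → Escapes k d
  escapes-later (i , k<i , r) = i , <⇒≤ k<i , r

  escape : ∀ t {k d} → mem k ≡ just d → Ans d (col (suc t + k)) → Escapes k d
  escape t {k} {d} h a with updateOf d (ρ (suc k))
  ... | reset _ eq    = suc k , n≤1+n k , inj₁ (trans (mem-suc h) eq)
  ... | raise _ d< eq = suc k , n≤1+n k , inj₂ (_ , trans (mem-suc h) eq , d<)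
  ... | keep na eq with t
  ...   | zero   = contradiction a na
  ...   | suc t′ = escapes-later (escape t′ (trans (mem-suc h) eq) a′)
    where
    a′ : Ans d (col (suc t′ + suc k))
    a′ = subst (λ i → Ans d (col i)) (cong suc (sym (+-suc t′ k))) a

  module AllAnswered (ℓ : ℕ) (bounded : ∀ v → Ω v < ℓ)
                     (answered : ∀ k → ∃ λ k′ → k′ ≥ k × Ans (col k) (col k′)) where

    escape-answered : ∀ {k d} → mem k ≡ just d → Escapes k d
    escape-answered {k} h with memory-pending k h
    ... | j , j≤k , refl , quiet with answered j
    ...   | k′ , j≤k′ , a with k′ ≤? k
    ...     | yes k′≤k = contradiction a (quiet k′ j≤k′ k′≤k)
    ...     | no k′≰k  = escape (k′ ∸ suc k) h (subst (λ i → Ans (col j) (col i)) k′≡ a)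
      where
      k′≡ : k′ ≡ suc (k′ ∸ suc k + k)
      k′≡ = trans (sym (m∸n+n≡m (≰⇒> k′≰k))) (+-suc (k′ ∸ suc k) k)

    memory<ℓ : ∀ k {d} → mem k ≡ just d → d < ℓ
    memory<ℓ k h with j , _ , refl , _ ← memory-pending k h = bounded (ρ j)

    -- Between resets the memory only grows, and it stays below ℓ, so s bounds the number of raises left.
    reset-after : ∀ s {k d} → mem k ≡ just d → ℓ ≤ s + d → ∃ λ k′ → k′ ≥ k × mem k′ ≡ nothing
    reset-after zero {k} h ℓ≤d = contradiction (memory<ℓ k h) (≤⇒≯ ℓ≤d)
    reset-after (suc s) h ℓ≤ with escape-answered h
    ... | i , k≤i , inj₁ r = i , k≤i , r
    ... | i , k≤i , inj₂ (e , h′ , d<e)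
      with k′ , i≤k′ , r ← reset-after s h′ (≤-trans ℓ≤ (+-monoʳ-< s d<e))
         = k′ , ≤-trans k≤i i≤k′ , r

    resets-infinitely-often : InfinitelyOften (λ k → mem k ≡ nothing)
    resets-infinitely-often k with mem k in h
    ... | nothing = k , ≤-refl , h
    ... | just d  = reset-after ℓ h (m≤m+n ℓ d)

  module EventuallyAtMost (c K : ℕ) (col≤c : ∀ k → k ≥ K → col k ≤ c) where

    col≤c-next : ∀ i → i ≥ K → col (suc i) ≤ c
    col≤c-next i K≤i = col≤c (suc i) (m≤n⇒m≤1+n K≤i)

    below-forever : Below c (mem K) → ∀ k → k ≥ K → Below c (mem k)
    below-forever b k K≤k =
      invariant (Below c) (λ i K≤i bi → below-step (mem i) bi (col≤c-next i K≤i)) b (≤⇒≤′ K≤k)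

    above-forever : Above c (mem K) → ∀ k → k ≥ K → Above c (mem k)
    above-forever a k K≤k =
      invariant (Above c) (λ i K≤i ai → above-step (mem i) ai (col≤c-next i K≤i)) a (≤⇒≤′ K≤k)

    below⇒resets : Even c → Below c (mem K) → InfinitelyOften (λ k → col k ≡ c) →
                   InfinitelyOften (λ k → mem k ≡ nothing)
    below⇒resets e b occ k with occ (suc (k ⊔ K))
    ... | suc i , s≤s k⊔K≤i , ci≡c =
      suc i , m≤n⇒m≤1+n (≤-trans (m≤m⊔n k K) k⊔K≤i) ,
      below-reset (mem i) e (below-forever b i (≤-trans (m≤n⊔m k K) k⊔K≤i)) ci≡c

module Priority {n} (A : Arena n) (Cst : CostFun n) (Ω : Fin n → ℕ) (ℓ : ℕ) (bounded : ∀ v → Ω v < ℓ) where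

  Ωᴹ : Fin n → Mem → ℕ
  Ωᴹ = Ω𝓜 A Cst Ω ℓ

  Ωᴹ≤1+ℓ : ∀ v x → Ωᴹ v x ≤ suc ℓ
  Ωᴹ≤1+ℓ v nothing = ≤-refl
  Ωᴹ≤1+ℓ v (just _) with InI? A Cst v
  ... | yes _ = n≤1+n ℓ
  ... | no _  = m≤n⇒m≤1+n (<⇒≤ (bounded v))

  Ωᴹ-outside-I : ∀ {v d} → ¬ InI A Cst v → Ωᴹ v (just d) ≡ Ω v
  Ωᴹ-outside-I {v} v∉I with InI? A Cst v
  ... | yes v∈I = contradiction v∈I v∉I
  ... | no _    = refl

  Ωᴹ-inside-I : ∀ {v} x → InI A Cst v → ℓ ≤ Ωᴹ v x
  Ωᴹ-inside-I nothing _ = n≤1+n ℓ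
  Ωᴹ-inside-I {v} (just _) v∈I with InI? A Cst v
  ... | yes _   = ≤-refl
  ... | no v∉I  = contradiction v∈I v∉I

  Ωᴹ<ℓ⇒Ω : ∀ {v} x → Ωᴹ v x < ℓ → Ωᴹ v x ≡ Ω v
  Ωᴹ<ℓ⇒Ω nothing 1+ℓ<ℓ = contradiction (<-trans (n<1+n ℓ) 1+ℓ<ℓ) (n≮n ℓ)
  Ωᴹ<ℓ⇒Ω {v} (just _) lt with InI? A Cst v
  ... | yes _ = contradiction lt (n≮n ℓ)
  ... | no _  = refl

  ℓ<Ωᴹ⇒reset : ∀ {v} x → ℓ < Ωᴹ v x → x ≡ nothing
  ℓ<Ωᴹ⇒reset nothing _ = refl
  ℓ<Ωᴹ⇒reset {v} (just _) lt with InI? A Cst v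
  ... | yes _ = contradiction lt (n≮n ℓ)
  ... | no _  = contradiction (<-trans lt (bounded v)) (n≮n ℓ)

module Reduction {n} (A : Arena n) (Cst : CostFun n) (Ω : Fin n → ℕ)
                 (ℓ : ℕ) (ℓ-odd : Odd ℓ) (bounded : ∀ v → Ω v < ℓ) (p : Play A) where
  open Memory Ω (ρ p)
  open Priority A Cst Ω ℓ bounded

  colᴹ : ℕ → ℕ
  colᴹ k = Ωᴹ (ρ p k) (mem k)

  resets⇒parity : InfinitelyOften (λ k → mem k ≡ nothing) → ParitySeq colᴹ
  resets⇒parity resets = parity-top colᴹ (odd⇒even-suc ℓ ℓ-odd) (λ k → Ωᴹ≤1+ℓ (ρ p k) (mem k)) occ
    where
    occ : InfinitelyOften (λ k → colᴹ k ≡ suc ℓ)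
    occ k with k′ , k≤k′ , r ← resets k = k′ , k≤k′ , cong (Ωᴹ (ρ p k′)) r

  RR⇒parity : RR Ω p → ParitySeq colᴹ
  RR⇒parity answered = resets⇒parity (AllAnswered.resets-infinitely-often ℓ bounded answered)

  atMost⇒parity : ∀ {c} K → (∀ k → k ≥ K → col k ≤ c) → (∀ k → k ≥ K → ¬ InI A Cst (ρ p k)) →
                  MaxInf col c → Even c → ParitySeq colᴹ
  atMost⇒parity {c} K col≤c ∉I max@(occ , _) c-even with below⊎above c (mem K)
  ... | inj₁ below = resets⇒parity (below⇒resets c-even below occ)
    where open EventuallyAtMost c K col≤c
  ... | inj₂ above = parity-eventually-equal K col≡colᴹ (c , max , c-even)
    where
    open EventuallyAtMost c K col≤c
    col≡colᴹ : ∀ k → k ≥ K → col k ≡ colᴹ k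
    col≡colᴹ k K≤k with d , eq , _ ← above-forever above k K≤k =
      sym (trans (cong (Ωᴹ (ρ p k)) eq) (Ωᴹ-outside-I {d = d} (∉I k K≤k)))

  parity×coBuchi⇒parity : Parity Ω p → coBuchi (InI A Cst) p → ParitySeq colᴹ
  parity×coBuchi⇒parity (c , (occ , k₁ , col≤c) , c-even) (k₂ , ∉I) =
    atMost⇒parity (k₁ ⊔ k₂) (λ k K≤k → col≤c k (≤-trans (m≤m⊔n k₁ k₂) K≤k))
                  (λ k K≤k → ∉I k (≤-trans (m≤n⊔m k₁ k₂) K≤k)) (occ , k₁ , col≤c) c-even

  parity⇒PCRR : ParitySeq colᴹ → PCRR Ω (InI A Cst) p
  parity⇒PCRR (c , max@(occ , k₀ , colᴹ≤c) , c-even) with c ≤? ℓ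
  ... | yes c≤ℓ = inj₁ (parity-eventually-equal k₀ colᴹ≡col (c , max , c-even) , k₀ , ∉I)
    where
    colᴹ<ℓ : ∀ k → k ≥ k₀ → colᴹ k < ℓ
    colᴹ<ℓ k k₀≤k = ≤-<-trans (colᴹ≤c k k₀≤k) (≤∧≢⇒< c≤ℓ (λ c≡ℓ → even⇒¬odd ℓ (subst Even c≡ℓ c-even) ℓ-odd))
    colᴹ≡col : ∀ k → k ≥ k₀ → colᴹ k ≡ col k
    colᴹ≡col k k₀≤k = Ωᴹ<ℓ⇒Ω (mem k) (colᴹ<ℓ k k₀≤k)
    ∉I : ∀ k → k ≥ k₀ → ¬ InI A Cst (ρ p k)
    ∉I k k₀≤k ∈I = <⇒≱ (colᴹ<ℓ k k₀≤k) (Ωᴹ-inside-I (mem k) ∈I)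
  ... | no c≰ℓ = inj₂ answered
    where
    answered : RR Ω p
    answered k with k′ , k≤k′ , colᴹk′≡c ← occ k =
      reset⇒answered k≤k′ (ℓ<Ωᴹ⇒reset (mem k′) (subst (ℓ <_) (sym colᴹk′≡c) (≰⇒> c≰ℓ)))

lemma3p3 : ∀ {n} (A : Arena n) (Cst : CostFun n) (Ω : Fin n → ℕ) →
    NoMixedIncoming A Cst →
    (ℓ : ℕ) → Odd ℓ → (∀ v → Ω v < ℓ) →
    (p : Play A) →
    PCRR Ω (InI A Cst) p ⇔ ParityExtended (Ω𝓜 A Cst Ω ℓ) (𝓜 Ω) p
lemma3p3 A Cst Ω _ ℓ ℓ-odd bounded p =
  mk⇔ [ uncurry parity×coBuchi⇒parity , RR⇒parity ] parity⇒PCRR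
  where open Reduction A Cst Ω ℓ ℓ-odd bounded p
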